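{- Given $n\geq 3$, let $\rho\in S_n$, with $\rho=(n-1)\alpha n$, for some $\alpha \in S_{n-2}$. Then the set of permutations $\pi$ whose output under PSB avoids $\rho$ is the permutation class $\mathrm{Av}(B)$, where $B=\{ (n-1)n\alpha \} \cup \{ (n+1)(n-1)\tau \, |\, \tau \text{ is a shuffle of the sequences } n \text{ and } \alpha,\ \tau\neq n\alpha \}$ (here $n\alpha$ denotes $\alpha$ with the element $n$ inserted at its front, and $\tau$ ranges over all sequences obtained by inserting $n$ anywhere into $\alpha$).
   Context: A pop stack with bypass supports three operations: PUSH (insert the current input element on top of the pop stack), POP (send all elements of the pop stack to the output, from top to bottom), and BYPASS (send the current input element directly to the output). The algorithm PSB processes the input permutation $\pi_1\cdots\pi_n$ from left to right: if the pop stack $S$ is empty or $\pi_i$ equals (top of $S$)$-1$, PUSH; else if $\pi_i <$ (top of $S$)$-1$, BYPASS; otherwise POP and then PUSH. At the end, a final POP is performed. This defines a map $\mathrm{PSB}: S\to S$. $\mathrm{Av}(B)$ is the set of permutations avoiding every pattern in $B$. A shuffle of two sequences $\rho,\sigma$ of distinct integers is a sequence containing both as subsequences and no other elements. -}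

module Defs where

open import Data.Nat using (ℕ; zero; suc; _<_; _<?_; _≟_; _∸_)
open import Data.List using (List; []; _∷_; _++_; map; upTo; [_])
open import Data.List.Relation.Binary.Permutation.Propositional using (_↭_)
open import Data.List.Relation.Binary.Sublist.Propositional using (_⊆_)
open import Data.List.Relation.Binary.Pointwise using (Pointwise)
open import Data.Product using (Σ; ∃; _×_)
open import Data.Sum using (_⊎_)
open import Relation.Binary.PropositionalEquality using (_≡_; _≢_)
open import Relation.Nullary using (¬_; yes; no)
open import Function.Bundles using (_⇔_)

IsPerm : ℕ → List ℕ → Set
IsPerm n p = p ↭ map suc (upTo n)

-- Order-isomorphism of two sequences: same length, and every pair of
-- positions i < j compares the same way in both sequences.
data OrderIso : List ℕ → List ℕ → Set where
  []  : OrderIso [] []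
  _∷_ : ∀ {x y xs ys} →
        Pointwise (λ a b → (x < a) ⇔ (y < b)) xs ys →
        OrderIso xs ys → OrderIso (x ∷ xs) (y ∷ ys)

Contains : List ℕ → List ℕ → Set
Contains π σ = ∃ λ s → (s ⊆ π) × OrderIso s σ

Avoids : List ℕ → List ℕ → Set
Avoids π σ = ¬ Contains π σ

InAv : (List ℕ → Set) → List ℕ → Set
InAv B π = ∀ β → B β → Avoids π β

data Shuffle : List ℕ → List ℕ → List ℕ → Set where
  []   : Shuffle [] [] []
  left : ∀ {x ρ σ τ} → Shuffle ρ σ τ → Shuffle (x ∷ ρ) σ (x ∷ τ)
  right : ∀ {x ρ σ τ} → Shuffle ρ σ τ → Shuffle ρ (x ∷ σ) (x ∷ τ)

-- The algorithm PSB.  psbRun S input: S is the pop stack, top first.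
psbRun : List ℕ → List ℕ → List ℕ
psbRun S [] = S
psbRun [] (x ∷ xs) = psbRun [ x ] xs
psbRun (t ∷ S) (x ∷ xs) with suc x ≟ t
... | yes _ = psbRun (x ∷ t ∷ S) xs
... | no _ with suc x <? t
...   | yes _ = x ∷ psbRun (t ∷ S) xs
...   | no _ = (t ∷ S) ++ psbRun [ x ] xs

PSB : List ℕ → List ℕ
PSB π = psbRun [] π

BasisB : ℕ → List ℕ → List ℕ → Set
BasisB n α β =
  (β ≡ (n ∸ 1) ∷ n ∷ α)
  ⊎ (∃ λ τ → Shuffle [ n ] α τ × (τ ≢ n ∷ α) × (β ≡ suc n ∷ (n ∸ 1) ∷ τ))

-- An occurrence c γ d of ρ in PSB π has γ ≅ α lying below c < d.
-- Call an obstruction for γ in π either an ascent c v γ (γ < c < v) or a hook t c τ, where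
-- τ is γ with one entry v inserted and γ < c < v < t; up to order isomorphism these are
-- exactly the occurrences of the elements of B.  Throughout the run the pop stack is a run
-- of consecutive values, smallest on top.
--
-- Given an obstruction, c has been output and the stack lies above c by the time γ is
-- read: in an ascent once v is read; in a hook because from t on the stack holds an entry
-- ≥ t, so that pushing c would put v on it and popping would put c on it, and c is
-- bypassed.  From then on the stack stays above c, so γ is bypassed in order and some
-- d > c is left on the final stack.
--
-- Conversely, the entry c of an occurrence is output before γ is read.  If c was popped,
-- the entry x triggering it is larger and c x γ is an ascent.  If c was bypassed under a top
-- t > c + 1, either some v with c < v < t follows c, giving a hook t c τ, or c + 1 (which
-- exists since π is a permutation) precedes c and has already been output; then the same
-- argument applies to c + 1 at an earlier position.

module Submission where

open import Defs
open import Data.Nat using (ℕ; suc; _≤_; _<_; _∸_; _≟_; _<?_; z≤n; s≤s)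
open import Data.Nat.Properties
open import Data.Product using (∃; ∃₂; _×_; _,_; proj₁; proj₂)
open import Data.Sum using (_⊎_; inj₁; inj₂)
open import Data.Empty using (⊥-elim)
open import Data.List using (List; []; _∷_; _++_; [_]; length; filter; map; upTo)
open import Data.List.Properties using (++-assoc; ++-identityʳ; filter-++; filter-all; filter-none; filter-reject)
open import Data.List.Membership.Propositional using (_∈_; _∉_; find; lose)
open import Data.List.Membership.Propositional.Properties
  using (∈-++⁺ˡ; ∈-++⁺ʳ; ∈-++⁻; ∈-map⁺; ∈-map⁻; ∈-upTo⁺; ∈-upTo⁻)
open import Data.List.Relation.Unary.Any using (Any; here; there; any?)
open import Data.List.Relation.Unary.All as All using (All; []; _∷_)
open import Data.List.Relation.Unary.All.Properties using (++⁻ˡ)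
open import Data.List.Relation.Unary.Unique.Propositional using (Unique; []; _∷_)
import Data.List.Relation.Unary.Unique.Propositional.Properties as Unique
open import Data.List.Relation.Binary.Pointwise as Pointwise using (Pointwise; []; _∷_)
open import Data.List.Relation.Binary.Sublist.Propositional using (_⊆_; []; _∷_; _∷ʳ_; ⊆-refl; ⊆-trans; from∈)
import Data.List.Relation.Binary.Sublist.Propositional.Properties as Sublist
open import Data.List.Relation.Binary.Permutation.Propositional as ↭
  using (_↭_; ↭-sym; ↭-trans; ↭-reflexive; ↭⇒↭ₛ)
import Data.List.Relation.Binary.Permutation.Propositional.Properties as ↭
import Data.List.Relation.Binary.Permutation.Setoid.Properties as ↭ₛ
open import Function using (_∘_; flip)
open import Function.Bundles using (_⇔_; mk⇔; Equivalence)
open import Relation.Nullary using (¬_; yes; no)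
open import Relation.Nullary.Decidable using (_×-dec_)
open import Relation.Binary.PropositionalEquality
  using (_≡_; _≢_; refl; sym; trans; cong; cong₂; subst; setoid; module ≡-Reasoning)

private
  variable
    a b c t v x y : ℕ
    S S′ E xs ys γ α τ π β : List ℕ
    P Q R : ℕ → ℕ → Set

Unique-resp-↭ : xs ↭ ys → Unique xs → Unique ys
Unique-resp-↭ p = ↭ₛ.Unique-resp-↭ (setoid ℕ) (↭⇒↭ₛ p)

Unique-resp-⊇ : xs ⊆ ys → Unique ys → Unique xs
Unique-resp-⊇ [] _ = []
Unique-resp-⊇ (_ ∷ʳ p) (_ ∷ u) = Unique-resp-⊇ p u
Unique-resp-⊇ (refl ∷ p) (x∉ ∷ u) = Sublist.All-resp-⊆ p x∉ ∷ Unique-resp-⊇ p u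

Unique-++-disjoint : ∀ xs → Unique (xs ++ ys) → x ∈ xs → y ∈ ys → x ≢ y
Unique-++-disjoint (_ ∷ xs) (x≢ ∷ _) (here refl) y∈ = All.lookup x≢ (∈-++⁺ʳ xs y∈)
Unique-++-disjoint (_ ∷ xs) (_ ∷ u) (there x∈) y∈ = Unique-++-disjoint xs u x∈ y∈

Unique-++⁻ʳ : ∀ xs → Unique (xs ++ ys) → Unique ys
Unique-++⁻ʳ [] u = u
Unique-++⁻ʳ (_ ∷ xs) (_ ∷ u) = Unique-++⁻ʳ xs u

Unique-∉ : ∀ xs → Unique (xs ++ y ∷ ys) → y ∉ ys
Unique-∉ xs u with Unique-++⁻ʳ xs u
... | y≢ ∷ _ = λ y∈ → All.lookup y≢ y∈ refl

∈⇒≢[] : x ∈ xs → xs ≢ []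
∈⇒≢[] (here _) ()
∈⇒≢[] (there _) ()

∷-⊆-split : (y ∷ ys) ⊆ xs → ∃₂ λ A B → xs ≡ A ++ y ∷ B × ys ⊆ B
∷-⊆-split (x ∷ʳ p) with ∷-⊆-split p
... | A , B , refl , ys⊆ = x ∷ A , B , refl , ys⊆
∷-⊆-split (refl ∷ p) = [] , _ , refl , p

∷-⊆-++ : ∀ {A B} → x ∈ A → ys ⊆ B → (x ∷ ys) ⊆ A ++ B
∷-⊆-++ {A = _ ∷ A} (here refl) p = refl ∷ Sublist.++⁺ˡ A p
∷-⊆-++ {A = y ∷ _} (there x∈) p = y ∷ʳ ∷-⊆-++ x∈ p

length-<-++-∷ : ∀ xs → length xs < length (xs ++ y ∷ ys)
length-<-++-∷ [] = s≤s z≤n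
length-<-++-∷ (_ ∷ xs) = s≤s (length-<-++-∷ xs)

IsPerm-Unique : ∀ m {π} → IsPerm m π → Unique π
IsPerm-Unique m p = Unique-resp-↭ (↭-sym p) (Unique.map⁺ suc-injective (Unique.upTo⁺ m))

IsPerm-∈⇒≤ : ∀ {m π} → IsPerm m π → y ∈ π → y ≤ m
IsPerm-∈⇒≤ p y∈ with ∈-map⁻ suc (↭.∈-resp-↭ p y∈)
... | _ , i∈ , refl = ∈-upTo⁻ i∈

IsPerm-≤⇒∈ : ∀ {m π} → IsPerm m π → suc y ≤ m → suc y ∈ π
IsPerm-≤⇒∈ p y<m = ↭.∈-resp-↭ (↭-sym p) (∈-map⁺ suc (∈-upTo⁺ y<m))

-- The pop stack with bypass, one step at a time

step : List ℕ → ℕ → List ℕ × List ℕ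
step [] x = [ x ] , []
step (t ∷ S) x with suc x ≟ t
... | yes _ = (x ∷ t ∷ S) , []
... | no _ with suc x <? t
...   | yes _ = (t ∷ S) , [ x ]
...   | no _ = [ x ] , (t ∷ S)

nextStack : List ℕ → ℕ → List ℕ
nextStack S x = proj₁ (step S x)

stepOutput : List ℕ → ℕ → List ℕ
stepOutput S x = proj₂ (step S x)

data StepView : List ℕ → ℕ → List ℕ → List ℕ → Set where
  start  : StepView [] x [ x ] []
  push   : StepView (suc x ∷ S) x (x ∷ suc x ∷ S) []
  bypass : suc x < t → StepView (t ∷ S) x (t ∷ S) [ x ]
  pop    : t ≤ x → StepView (t ∷ S) x [ x ] (t ∷ S)

stepView : ∀ S x → StepView S x (nextStack S x) (stepOutput S x)
stepView [] x = start
stepView (t ∷ S) x with suc x ≟ t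
... | yes refl = push
... | no 1+x≢t with suc x <? t
...   | yes 1+x<t = bypass 1+x<t
...   | no 1+x≮t = pop (≤-pred (≤∧≢⇒< (≮⇒≥ 1+x≮t) (1+x≢t ∘ sym)))

stackAfter : List ℕ → List ℕ → List ℕ
stackAfter S [] = S
stackAfter S (x ∷ xs) = stackAfter (nextStack S x) xs

emitted : List ℕ → List ℕ → List ℕ
emitted S [] = []
emitted S (x ∷ xs) = stepOutput S x ++ emitted (nextStack S x) xs

psbRun-step : ∀ S x xs → psbRun S (x ∷ xs) ≡ stepOutput S x ++ psbRun (nextStack S x) xs
psbRun-step [] x xs = refl
psbRun-step (t ∷ S) x xs with suc x ≟ t
... | yes _ = refl
... | no _ with suc x <? t
...   | yes _ = refl
...   | no _ = refl

psbRun-++ : ∀ S xs ys → psbRun S (xs ++ ys) ≡ emitted S xs ++ psbRun (stackAfter S xs) ys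
psbRun-++ S [] ys = refl
psbRun-++ S (x ∷ xs) ys = begin
  psbRun S (x ∷ xs ++ ys)                                    ≡⟨ psbRun-step S x (xs ++ ys) ⟩
  out ++ psbRun next (xs ++ ys)                              ≡⟨ cong (out ++_) (psbRun-++ next xs ys) ⟩
  out ++ emitted next xs ++ psbRun (stackAfter next xs) ys   ≡⟨ ++-assoc out _ _ ⟨
  emitted S (x ∷ xs) ++ psbRun (stackAfter S (x ∷ xs)) ys    ∎
  where
    open ≡-Reasoning
    out = stepOutput S x
    next = nextStack S x

stackAfter-++ : ∀ S xs ys → stackAfter S (xs ++ ys) ≡ stackAfter (stackAfter S xs) ys
stackAfter-++ S [] ys = refl
stackAfter-++ S (x ∷ xs) ys = stackAfter-++ _ xs ys

psbRun-split : ∀ S xs → psbRun S xs ≡ emitted S xs ++ stackAfter S xs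
psbRun-split S xs = begin
  psbRun S xs                          ≡⟨ cong (psbRun S) (sym (++-identityʳ xs)) ⟩
  psbRun S (xs ++ [])                  ≡⟨ psbRun-++ S xs [] ⟩
  emitted S xs ++ stackAfter S xs      ∎
  where open ≡-Reasoning

StepView-↭ : StepView S x S′ E → E ++ S′ ↭ S ++ [ x ]
StepView-↭ start = ↭.refl
StepView-↭ (push {x} {S}) = ↭.++-comm [ x ] (suc x ∷ S)
StepView-↭ (bypass {x = x} {t} {S} _) = ↭.++-comm [ x ] (t ∷ S)
StepView-↭ (pop _) = ↭.refl

emitted++stackAfter-↭ : ∀ S xs → emitted S xs ++ stackAfter S xs ↭ S ++ xs
emitted++stackAfter-↭ S [] = ↭-reflexive (sym (++-identityʳ S))
emitted++stackAfter-↭ S (x ∷ xs) = begin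
  (out ++ emitted next xs) ++ stackAfter next xs   ≡⟨ ++-assoc out _ _ ⟩
  out ++ emitted next xs ++ stackAfter next xs     ↭⟨ ↭.++⁺ˡ out (emitted++stackAfter-↭ next xs) ⟩
  out ++ next ++ xs                                ≡⟨ sym (++-assoc out next xs) ⟩
  (out ++ next) ++ xs                              ↭⟨ ↭.++⁺ʳ xs (StepView-↭ (stepView S x)) ⟩
  (S ++ [ x ]) ++ xs                               ≡⟨ ++-assoc S [ x ] xs ⟩
  S ++ x ∷ xs                                      ∎
  where
    open ↭.PermutationReasoning
    out = stepOutput S x
    next = nextStack S x

∈-stackAfter⁻ : ∀ S xs → y ∈ stackAfter S xs → y ∈ S ++ xs
∈-stackAfter⁻ S xs y∈ = ↭.∈-resp-↭ (emitted++stackAfter-↭ S xs) (∈-++⁺ʳ (emitted S xs) y∈)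

∈-stepOutput⁻ : ∀ S x → y ∈ stepOutput S x → y ∈ S ++ [ x ]
∈-stepOutput⁻ S x y∈ = ↭.∈-resp-↭ (StepView-↭ (stepView S x)) (∈-++⁺ˡ y∈)

∈-emitted⊎stackAfter : ∀ S xs → y ∈ S ++ xs → y ∈ emitted S xs ⊎ y ∈ stackAfter S xs
∈-emitted⊎stackAfter S xs y∈ =
  ∈-++⁻ (emitted S xs) (↭.∈-resp-↭ (↭-sym (emitted++stackAfter-↭ S xs)) y∈)

Unique-stackAfter : ∀ S xs → Unique (S ++ xs ++ ys) → Unique (stackAfter S xs ++ ys)
Unique-stackAfter {ys} S xs u = Unique-++⁻ʳ (emitted S xs) (Unique-resp-↭ reorder u)
  where
    reorder : S ++ xs ++ ys ↭ emitted S xs ++ stackAfter S xs ++ ys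
    reorder = ↭-sym (↭-trans (↭-reflexive (sym (++-assoc (emitted S xs) _ ys)))
                (↭-trans (↭.++⁺ʳ ys (emitted++stackAfter-↭ S xs)) (↭-reflexive (++-assoc S xs ys))))

stackAfter-∉ : ∀ xs → Unique (xs ++ x ∷ ys) → x ∉ stackAfter [] xs
stackAfter-∉ xs u x∈ = Unique-++-disjoint xs u (∈-stackAfter⁻ [] xs x∈) (here refl) refl

PSB-Unique : Unique xs → Unique (PSB xs)
PSB-Unique {xs} u rewrite psbRun-split [] xs = Unique-resp-↭ (↭-sym (emitted++stackAfter-↭ [] xs)) u

emitted-step : ∀ S xs → y ∈ emitted S xs →
  ∃₂ λ p₁ x → ∃ λ p₂ → xs ≡ p₁ ++ x ∷ p₂ × y ∈ stepOutput (stackAfter S p₁) x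
emitted-step S (x ∷ xs) y∈ with ∈-++⁻ (stepOutput S x) y∈
... | inj₁ y∈out = [] , x , xs , refl , y∈out
... | inj₂ y∈rest with emitted-step (nextStack S x) xs y∈rest
...   | p₁ , x′ , p₂ , refl , y∈out = x ∷ p₁ , x′ , p₂ , refl , y∈out

data Consecutive : List ℕ → Set where
  []        : Consecutive []
  singleton : Consecutive [ x ]
  extend    : Consecutive (suc x ∷ S) → Consecutive (x ∷ suc x ∷ S)

StepView-Consecutive : StepView S x S′ E → Consecutive S → Consecutive S′
StepView-Consecutive start _ = singleton
StepView-Consecutive push cs = extend cs
StepView-Consecutive (bypass _) cs = cs
StepView-Consecutive (pop _) _ = singleton

StepView-Consecutive-output : StepView S x S′ E → Consecutive S → Consecutive E
StepView-Consecutive-output start _ = []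
StepView-Consecutive-output push _ = []
StepView-Consecutive-output (bypass _) _ = singleton
StepView-Consecutive-output (pop _) cs = cs

stackAfter-Consecutive : ∀ S xs → Consecutive S → Consecutive (stackAfter S xs)
stackAfter-Consecutive S [] cs = cs
stackAfter-Consecutive S (x ∷ xs) cs = stackAfter-Consecutive _ xs (StepView-Consecutive (stepView S x) cs)

Consecutive-tail : Consecutive (x ∷ S) → Consecutive S
Consecutive-tail singleton = []
Consecutive-tail (extend cs) = cs

Consecutive-head≤ : Consecutive (t ∷ S) → y ∈ t ∷ S → t ≤ y
Consecutive-head≤ _ (here refl) = ≤-refl
Consecutive-head≤ (extend cs) (there y∈) = ≤-trans (n≤1+n _) (Consecutive-head≤ cs y∈)

Consecutive-head< : Consecutive (t ∷ S) → All (t <_) S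
Consecutive-head< singleton = []
Consecutive-head< (extend cs) = All.tabulate (Consecutive-head≤ cs)

Consecutive-interval : ∀ {v} → Consecutive (t ∷ S) → y ∈ t ∷ S → t ≤ v → v ≤ y → v ∈ t ∷ S
Consecutive-interval {t} {v = v} cs y∈ t≤v v≤y with v ≟ t
... | yes refl = here refl
Consecutive-interval singleton (here refl) t≤v v≤y | no v≢t = ⊥-elim (v≢t (≤-antisym v≤y t≤v))
Consecutive-interval (extend cs) (here refl) t≤v v≤y | no v≢t = ⊥-elim (v≢t (≤-antisym v≤y t≤v))
Consecutive-interval (extend cs) (there y∈) t≤v v≤y | no v≢t =
  there (Consecutive-interval cs y∈ (≤∧≢⇒< t≤v (v≢t ∘ sym)) v≤y)

Consecutive-<-absent : Consecutive (t ∷ S) → c ∈ t ∷ S → t ≤ x → x ∉ t ∷ S → c < x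
Consecutive-<-absent cs c∈ t≤x x∉ = ≰⇒> (λ x≤c → x∉ (Consecutive-interval cs c∈ t≤x x≤c))

data NonEmptyAll (P : ℕ → Set) : List ℕ → Set where
  _∷_ : P x → All P S → NonEmptyAll P (x ∷ S)

module _ {P : ℕ → Set} where

  NonEmptyAll⇒All : NonEmptyAll P S → All P S
  NonEmptyAll⇒All (p ∷ ps) = p ∷ ps

  NonEmptyAll-map : ∀ {Q : ℕ → Set} → (∀ {y} → P y → Q y) → NonEmptyAll P S → NonEmptyAll Q S
  NonEmptyAll-map f (p ∷ ps) = f p ∷ All.map f ps

  NonEmptyAll⇒Any : NonEmptyAll P S → Any P S
  NonEmptyAll⇒Any (p ∷ _) = here p

Above : ℕ → List ℕ → Set
Above c = NonEmptyAll (c <_)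

Consecutive-Above : Consecutive (t ∷ S) → c < t → Above c (t ∷ S)
Consecutive-Above cs c<t = c<t ∷ All.map (<-trans c<t) (Consecutive-head< cs)

StepView-≥ : Consecutive S → StepView S x S′ E → NonEmptyAll (x ≤_) S′
StepView-≥ _ start = ≤-refl ∷ []
StepView-≥ cs push = ≤-refl ∷ NonEmptyAll⇒All (NonEmptyAll-map <⇒≤ (Consecutive-Above cs (n<1+n _)))
StepView-≥ cs (bypass 1+x<t) = NonEmptyAll-map <⇒≤ (Consecutive-Above cs (<-trans (n<1+n _) 1+x<t))
StepView-≥ _ (pop _) = ≤-refl ∷ []

StepView-Above : Above c S → x ≢ c → StepView S x S′ E → Above c S′
StepView-Above (c<1+x ∷ rest) x≢c push = ≤∧≢⇒< (≤-pred c<1+x) (x≢c ∘ sym) ∷ c<1+x ∷ rest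
StepView-Above above _ (bypass _) = above
StepView-Above (c<t ∷ _) _ (pop t≤x) = <-≤-trans c<t t≤x ∷ []

stackAfter-Above : ∀ S xs → Above c S → c ∉ xs → Above c (stackAfter S xs)
stackAfter-Above S [] above _ = above
stackAfter-Above S (x ∷ xs) above c∉ =
  stackAfter-Above _ xs (StepView-Above above (c∉ ∘ here ∘ sym) (stepView S x)) (c∉ ∘ there)

StepView-emits-Above : Consecutive S → x ∉ S → StepView S x S′ E → c ∈ E → Above c S′
StepView-emits-Above cs _ (bypass 1+x<t) (here refl) = Consecutive-Above cs (<-trans (n<1+n _) 1+x<t)
StepView-emits-Above cs x∉ (pop t≤x) c∈ = Consecutive-<-absent cs c∈ t≤x x∉ ∷ []

StepView-Any≤ : Consecutive S → x ∉ S → StepView S x S′ E → Any (y ≤_) S → Any (y ≤_) S′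
StepView-Any≤ _ _ push reach = there reach
StepView-Any≤ _ _ (bypass _) reach = reach
StepView-Any≤ cs x∉ (pop t≤x) reach with find reach
... | z , z∈ , y≤z = here (≤-trans y≤z (<⇒≤ (Consecutive-<-absent cs z∈ t≤x x∉)))

stackAfter-Any≤ : ∀ S xs → Consecutive S → Unique (S ++ xs ++ ys) → Any (y ≤_) S →
                  Any (y ≤_) (stackAfter S xs)
stackAfter-Any≤ S [] _ _ reach = reach
stackAfter-Any≤ S (x ∷ xs) cs u reach =
  stackAfter-Any≤ _ xs (StepView-Consecutive view cs) (Unique-stackAfter S [ x ] u)
    (StepView-Any≤ cs (λ x∈ → Unique-++-disjoint S u x∈ (here refl) refl) view reach)
  where view = stepView S x

stackAfter-reaches : ∀ S xs → Consecutive S → Unique (S ++ t ∷ xs ++ ys) →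
                     Any (t ≤_) (stackAfter S (t ∷ xs))
stackAfter-reaches S xs cs u =
  stackAfter-Any≤ _ xs (StepView-Consecutive view cs) (Unique-stackAfter S [ _ ] u)
    (NonEmptyAll⇒Any (StepView-≥ cs view))
  where view = stepView S _

StepView-forced-bypass : ∀ {d} → Consecutive S → Any (t ≤_) S → c ∉ S → d ∉ S → c < d → d < t →
                         StepView S c S′ E → Above c S′
StepView-forced-bypass cs reach _ d∉ c<d d<t push with find reach
... | z , z∈ , t≤z = ⊥-elim (d∉ (Consecutive-interval cs z∈ c<d (<⇒≤ (<-≤-trans d<t t≤z))))
StepView-forced-bypass cs _ _ _ _ _ (bypass 1+c<t) = Consecutive-Above cs (<-trans (n<1+n _) 1+c<t)
StepView-forced-bypass cs reach c∉ _ c<d d<t (pop t≤c) with find reach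
... | z , z∈ , t≤z = ⊥-elim (c∉ (Consecutive-interval cs z∈ t≤c (<⇒≤ (<-trans c<d (<-≤-trans d<t t≤z)))))

below : ℕ → List ℕ → List ℕ
below c = filter (_<? c)

StepView-below : Above c S → x ≢ c → StepView S x S′ E → below c E ≡ below c [ x ]
StepView-below (c<1+x ∷ _) x≢c push =
  sym (filter-reject (_<? _) (<⇒≯ (≤∧≢⇒< (≤-pred c<1+x) (x≢c ∘ sym))))
StepView-below _ _ (bypass _) = refl
StepView-below above _ (pop t≤x) with above
... | c<t ∷ _ = trans (filter-none (_<? _) (All.map <⇒≯ (NonEmptyAll⇒All above)))
                      (sym (filter-reject (_<? _) (<⇒≯ (<-≤-trans c<t t≤x))))

emitted-below : ∀ S xs → Above c S → c ∉ xs → below c (emitted S xs) ≡ below c xs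
emitted-below S [] _ _ = refl
emitted-below {c} S (x ∷ xs) above c∉ = begin
  below c (stepOutput S x ++ emitted (nextStack S x) xs)          ≡⟨ filter-++ (_<? c) (stepOutput S x) _ ⟩
  below c (stepOutput S x) ++ below c (emitted (nextStack S x) xs)
    ≡⟨ cong₂ _++_ (StepView-below above x≢c view)
                  (emitted-below _ xs (StepView-Above above x≢c view) (c∉ ∘ there)) ⟩
  below c [ x ] ++ below c xs                                     ≡⟨ filter-++ (_<? c) [ x ] xs ⟨
  below c (x ∷ xs)                                                ∎
  where
    open ≡-Reasoning
    view = stepView S x
    x≢c = c∉ ∘ here ∘ sym

psbRun-below : ∀ S xs → Above c S → c ∉ xs → below c (psbRun S xs) ≡ below c xs
psbRun-below {c} S xs above c∉ = begin
  below c (psbRun S xs)                                ≡⟨ cong (below c) (psbRun-split S xs) ⟩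
  below c (emitted S xs ++ stackAfter S xs)            ≡⟨ filter-++ (_<? c) (emitted S xs) _ ⟩
  below c (emitted S xs) ++ below c (stackAfter S xs)  ≡⟨ cong₂ _++_ (emitted-below S xs above c∉) stack-empty ⟩
  below c xs ++ []                                     ≡⟨ ++-identityʳ _ ⟩
  below c xs                                           ∎
  where
    open ≡-Reasoning
    stack-empty : below c (stackAfter S xs) ≡ []
    stack-empty = filter-none (_<? c) (All.map <⇒≯ (NonEmptyAll⇒All (stackAfter-Above S xs above c∉)))

⊆-below : All (_< c) γ → γ ⊆ xs → γ ⊆ below c xs
⊆-below {c} γ<c γ⊆ =
  subst (_⊆ _) (filter-all (_<? c) γ<c) (Sublist.filter⁺ (_<? c) (_<? c) (λ { refl p → p }) γ⊆)

below-⊆-emitted : ∀ S xs → Above c S → c ∉ xs → All (_< c) γ → γ ⊆ xs → γ ⊆ emitted S xs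
below-⊆-emitted {c} S xs above c∉ γ<c γ⊆ =
  ⊆-trans (subst (_ ⊆_) (sym (emitted-below S xs above c∉)) (⊆-below γ<c γ⊆))
          (Sublist.filter-⊆ (_<? c) (emitted S xs))

below-⊆-input : ∀ S xs → Above c S → c ∉ xs → All (_< c) γ → γ ⊆ psbRun S xs → γ ⊆ xs
below-⊆-input {c} S xs above c∉ γ<c γ⊆ =
  ⊆-trans (subst (_ ⊆_) (psbRun-below S xs above c∉) (⊆-below γ<c γ⊆)) (Sublist.filter-⊆ (_<? c) xs)

⊆-skip-above : ∀ E {R} → All (c <_) E → All (_< c) γ → γ ⊆ E ++ R → γ ⊆ R
⊆-skip-above {c} E {R} E>c γ<c γ⊆ =
  ⊆-trans (subst (_ ⊆_) below≡ (⊆-below γ<c γ⊆)) (Sublist.filter-⊆ (_<? c) R)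
  where
    below≡ : below c (E ++ R) ≡ below c R
    below≡ = trans (filter-++ (_<? c) E R) (cong (_++ below c R) (filter-none (_<? c) (All.map <⇒≯ E>c)))

-- Order isomorphisms and shuffles

Agree : ℕ → ℕ → ℕ → ℕ → Set
Agree x y a b = (x < a) ⇔ (y < b)

agree-< : x < a → y < b → Agree x y a b
agree-< x<a y<b = mk⇔ (λ _ → y<b) (λ _ → x<a)

agree-> : a < x → b < y → Agree x y a b
agree-> a<x b<y = mk⇔ (⊥-elim ∘ <-asym a<x) (⊥-elim ∘ <-asym b<y)

Pointwise-zip : Pointwise P xs ys → Pointwise Q xs ys → Pointwise (λ a b → P a b × Q a b) xs ys
Pointwise-zip [] [] = []
Pointwise-zip (p ∷ ps) (q ∷ qs) = (p , q) ∷ Pointwise-zip ps qs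

OrderIso-pointwise : ∀ {P Q : ℕ → Set} → OrderIso xs ys → All P xs → All Q ys →
                     (∀ {a b} → P a → Q b → R a b) → Pointwise R xs ys
OrderIso-pointwise [] [] [] f = []
OrderIso-pointwise (_ ∷ iso) (p ∷ ps) (q ∷ qs) f = f p q ∷ OrderIso-pointwise iso ps qs f

Agree-below : Pointwise (Agree c y) γ α → All (_< y) α → All (c ≢_) γ → All (_< c) γ
Agree-below [] [] [] = []
Agree-below (agree ∷ agrees) (a<y ∷ α<y) (c≢g ∷ c≢γ) =
  ≤∧≢⇒< (≮⇒≥ (<-asym a<y ∘ Equivalence.to agree)) (c≢g ∘ sym) ∷ Agree-below agrees α<y c≢γ

OrderIso-≢[] : OrderIso γ α → α ≢ [] → γ ≢ []
OrderIso-≢[] [] α≢[] refl = α≢[] refl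

OrderIso-∷ʳ-max : OrderIso xs ys → All (_< x) xs → All (_< y) ys → OrderIso (xs ++ [ x ]) (ys ++ [ y ])
OrderIso-∷ʳ-max [] [] [] = [] ∷ []
OrderIso-∷ʳ-max (agrees ∷ iso) (a<x ∷ xs<x) (b<y ∷ ys<y) =
  Pointwise.++⁺ agrees (agree-< a<x b<y ∷ []) ∷ OrderIso-∷ʳ-max iso xs<x ys<y

OrderIso-unsnoc : ∀ ys → OrderIso xs (ys ++ [ y ]) → Pointwise R xs (ys ++ [ y ]) →
                  ∃₂ λ γ x → xs ≡ γ ++ [ x ] × OrderIso γ ys × Pointwise R γ ys
OrderIso-unsnoc [] (_ ∷ []) _ = [] , _ , refl , [] , []
OrderIso-unsnoc (_ ∷ ys) (agrees ∷ iso) (r ∷ rs) with OrderIso-unsnoc ys iso (Pointwise-zip rs agrees)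
... | γ , x , refl , isoγ , rs′ =
  _ ∷ γ , x , refl , Pointwise.map proj₂ rs′ ∷ isoγ , r ∷ Pointwise.map proj₁ rs′

Shuffle-[]ˡ⁺ : ∀ γ → Shuffle [] γ γ
Shuffle-[]ˡ⁺ [] = []
Shuffle-[]ˡ⁺ (_ ∷ γ) = right (Shuffle-[]ˡ⁺ γ)

Shuffle-[]ˡ⁻ : Shuffle [] γ τ → τ ≡ γ
Shuffle-[]ˡ⁻ [] = refl
Shuffle-[]ˡ⁻ (right s) = cong (_ ∷_) (Shuffle-[]ˡ⁻ s)

Shuffle-⊆ʳ : Shuffle [ v ] γ τ → γ ⊆ τ
Shuffle-⊆ʳ (left s) rewrite Shuffle-[]ˡ⁻ s = _ ∷ʳ ⊆-refl
Shuffle-⊆ʳ (right s) = refl ∷ Shuffle-⊆ʳ s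

Shuffle-∈ˡ : Shuffle [ v ] γ τ → v ∈ τ
Shuffle-∈ˡ (left _) = here refl
Shuffle-∈ˡ (right s) = there (Shuffle-∈ˡ s)

Shuffle-⊆ : ∀ {L} → v ∈ L → γ ⊆ L → v ∉ γ → ∃ λ τ → τ ⊆ L × Shuffle [ v ] γ τ
Shuffle-⊆ (here refl) (_ ∷ʳ γ⊆) _ = _ , refl ∷ γ⊆ , left (Shuffle-[]ˡ⁺ _)
Shuffle-⊆ (here refl) (refl ∷ _) v∉ = ⊥-elim (v∉ (here refl))
Shuffle-⊆ (there v∈) (y ∷ʳ γ⊆) v∉ with Shuffle-⊆ v∈ γ⊆ v∉
... | τ , τ⊆ , s = τ , y ∷ʳ τ⊆ , s
Shuffle-⊆ (there v∈) (refl ∷ γ⊆) v∉ with Shuffle-⊆ v∈ γ⊆ (v∉ ∘ there)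
... | τ , τ⊆ , s = _ ∷ τ , refl ∷ τ⊆ , right s

OrderIso-insert-max : ∀ {n} → Shuffle [ v ] γ τ → OrderIso γ α →
  Pointwise (λ a b → R a b × a < v × b < n) γ α → R v n →
  ∃ λ τα → Shuffle [ n ] α τα × OrderIso τ τα × Pointwise R τ τα
OrderIso-insert-max {α = α} {n = n} (left s) iso rs rv rewrite Shuffle-[]ˡ⁻ s =
  n ∷ α , left (Shuffle-[]ˡ⁺ α) ,
  Pointwise.map (λ (_ , a<v , b<n) → agree-> a<v b<n) rs ∷ iso , rv ∷ Pointwise.map proj₁ rs
OrderIso-insert-max (right s) (agrees ∷ iso) ((rg , g<v , a<n) ∷ rs) rv
  with OrderIso-insert-max s iso
         (Pointwise.map (λ ((r , bounds) , agree) → (r , agree) , bounds) (Pointwise-zip rs agrees))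
         (rv , agree-< g<v a<n)
... | τα , sα , isoτ , rs′ =
  _ ∷ τα , right sα , Pointwise.map proj₂ rs′ ∷ isoτ , rg ∷ Pointwise.map proj₁ rs′

OrderIso-extract : ∀ {n τα} → Shuffle [ n ] α τα → OrderIso τ τα → Pointwise R τ τα →
  ∃₂ λ d γ → Shuffle [ d ] γ τ × OrderIso γ α × R d n × Pointwise R γ α
OrderIso-extract (left s) (_ ∷ iso) (rd ∷ rs) with Shuffle-[]ˡ⁻ s
... | refl = _ , _ , left (Shuffle-[]ˡ⁺ _) , iso , rd , rs
OrderIso-extract (right s) (agrees ∷ iso) (rg ∷ rs) with OrderIso-extract s iso (Pointwise-zip rs agrees)
... | d , γ , sγ , isoγ , (rd , _) , rs′ =
  d , _ ∷ γ , right sγ , Pointwise.map proj₂ rs′ ∷ isoγ , rd , rg ∷ Pointwise.map proj₁ rs′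

OutputPattern : List ℕ → List ℕ → Set
OutputPattern xs γ = ∃₂ λ c d → All (_< c) γ × c < d × (c ∷ γ ++ [ d ]) ⊆ xs

ρ-occurrence⁻ : All (_< a) α → Unique xs → Contains xs (a ∷ α ++ [ b ]) →
                ∃ λ γ → OrderIso γ α × ∃ λ c → All (_< c) γ × (c ∷ γ) ⊆ xs
ρ-occurrence⁻ {α = α} α<a u (c ∷ _ , sub , agrees ∷ iso) with OrderIso-unsnoc α iso agrees
... | γ , d , refl , isoγ , agreesγ with Unique-resp-⊇ sub u
...   | c≢ ∷ _ =
  γ , isoγ , c , Agree-below agreesγ α<a (++⁻ˡ γ c≢) , ⊆-trans (refl ∷ Sublist.++⁺ʳ [ d ] ⊆-refl) sub

ρ-occurrence⁺ : All (_< a) α → a < b → OrderIso γ α → OutputPattern xs γ → Contains xs (a ∷ α ++ [ b ])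
ρ-occurrence⁺ α<a a<b iso (_ , _ , γ<c , c<d , sub) =
  _ , sub , Pointwise.++⁺ (OrderIso-pointwise iso γ<c α<a agree->) (agree-< c<d a<b ∷ [])
          ∷ OrderIso-∷ʳ-max iso (All.map (flip <-trans c<d) γ<c) (All.map (flip <-trans a<b) α<a)

-- The two shapes of basis element, (n-1) n α and (n+1)(n-1)τ, read on actual entries.
data Obstruction (π γ : List ℕ) : Set where
  ascent : All (_< c) γ → c < v → (c ∷ v ∷ γ) ⊆ π → Obstruction π γ
  hook   : All (_< c) γ → c < v → v < t → Shuffle [ v ] γ τ → (t ∷ c ∷ τ) ⊆ π → Obstruction π γ

ascent-OrderIso : All (_< a) α → a < b → OrderIso γ α → All (_< c) γ → c < v →
                  OrderIso (c ∷ v ∷ γ) (a ∷ b ∷ α)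
ascent-OrderIso α<a a<b iso γ<c c<v =
  (agree-< c<v a<b ∷ OrderIso-pointwise iso γ<c α<a agree->)
  ∷ OrderIso-pointwise iso (All.map (flip <-trans c<v) γ<c) (All.map (flip <-trans a<b) α<a) agree->
  ∷ iso

module BasisTranslation {n : ℕ} {α : List ℕ} (α<n-1 : All (_< n ∸ 1) α) (n-1<n : n ∸ 1 < n) where

  private
    n-1<n+1 : n ∸ 1 < suc n
    n-1<n+1 = <-trans n-1<n (n<1+n n)

  obstruction⇒basis : OrderIso γ α → Obstruction π γ → ∃ λ β → BasisB n α β × Contains π β
  obstruction⇒basis iso (ascent γ<c c<v sub) =
    _ , inj₁ refl , _ , sub , ascent-OrderIso α<n-1 n-1<n iso γ<c c<v
  obstruction⇒basis iso (hook γ<c c<v v<t (left s) sub) rewrite Shuffle-[]ˡ⁻ s =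
    obstruction⇒basis iso (ascent γ<c c<v (Sublist.∷ˡ⁻ sub))
  obstruction⇒basis {γ = g ∷ γ} iso (hook {c = c} {t = t} (g<c ∷ γ<c) c<v v<t (right s) sub)
    with OrderIso-insert-max {R = λ a b → Agree t (suc n) a b × Agree c (n ∸ 1) a b} (right s) iso
           (OrderIso-pointwise iso (g<c ∷ γ<c) α<n-1 λ a<c b<n-1 →
              (agree-> (<-trans a<c (<-trans c<v v<t)) (<-trans b<n-1 n-1<n+1) , agree-> a<c b<n-1) ,
              <-trans a<c c<v , <-trans b<n-1 n-1<n)
           (agree-> v<t (n<1+n n) , agree-< c<v n-1<n)
  ... | τα , sα , isoτ , agrees =
    _ , inj₂ (τα , sα , not-first agrees , refl) , _ , sub ,
    (agree-> (<-trans c<v v<t) n-1<n+1 ∷ Pointwise.map proj₁ agrees) ∷ Pointwise.map proj₂ agrees ∷ isoτ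
    where
      not-first : ∀ {τ τα} → Pointwise (λ a b → Agree t (suc n) a b × Agree c (n ∸ 1) a b) (g ∷ τ) τα →
                  τα ≢ n ∷ α
      not-first ((_ , agree) ∷ _) refl = <-asym g<c (Equivalence.from agree n-1<n)

  basis⇒obstruction : Unique π → BasisB n α β → Contains π β → ∃ λ γ → OrderIso γ α × Obstruction π γ
  basis⇒obstruction u (inj₁ refl) (c ∷ v ∷ γ , sub , (agree ∷ agreesγ) ∷ _ ∷ isoγ) with Unique-resp-⊇ sub u
  ... | (_ ∷ c≢γ) ∷ _ = γ , isoγ , ascent (Agree-below agreesγ α<n-1 c≢γ) (Equivalence.from agree n-1<n) sub
  basis⇒obstruction u (inj₂ (_ , sα , _ , refl)) (e ∷ c ∷ τ , sub , (_ ∷ agreesₑ) ∷ agreesc ∷ isoτ)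
    with OrderIso-extract sα isoτ (Pointwise-zip agreesₑ agreesc) | Unique-resp-⊇ sub u
  ... | d , γ , sγ , isoγ , (agreeₑ , agreec) , agreesγ | (_ ∷ e≢τ) ∷ c≢τ ∷ _ =
    γ , isoγ , hook γ<c c<d d<e sγ sub
    where
      c<d = Equivalence.from agreec n-1<n
      d<e = ≤∧≢⇒< (≮⇒≥ (<-asym (n<1+n n) ∘ Equivalence.to agreeₑ)) (All.lookup e≢τ (Shuffle-∈ˡ sγ) ∘ sym)
      γ<c = Agree-below (Pointwise.map proj₂ agreesγ) α<n-1 (Sublist.All-resp-⊆ (Shuffle-⊆ʳ sγ) c≢τ)

-- From an obstruction to an occurrence in the output

output-pattern : ∀ pre post → c ∈ pre → Above c (stackAfter [] pre) → c ∉ post →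
                 All (_< c) γ → γ ⊆ post → OutputPattern (PSB (pre ++ post)) γ
output-pattern {c} {γ} pre post c∈ above c∉ γ<c γ⊆
  with find (NonEmptyAll⇒Any (stackAfter-Above (stackAfter [] pre) post above c∉))
... | d , d∈ , c<d = c , d , γ<c , c<d , subst ((c ∷ γ ++ [ d ]) ⊆_) (sym PSB≡) occurrence
  where
    stack = stackAfter [] pre
    PSB≡ : PSB (pre ++ post) ≡ emitted [] pre ++ emitted stack post ++ stackAfter stack post
    PSB≡ = trans (psbRun-++ [] pre post) (cong (emitted [] pre ++_) (psbRun-split stack post))
    c-emitted : c ∈ emitted [] pre
    c-emitted with ∈-emitted⊎stackAfter [] pre c∈
    ... | inj₁ c∈emitted = c∈emitted
    ... | inj₂ c∈stack = ⊥-elim (<-irrefl refl (All.lookup (NonEmptyAll⇒All above) c∈stack))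
    occurrence : (c ∷ γ ++ [ d ]) ⊆ emitted [] pre ++ emitted stack post ++ stackAfter stack post
    occurrence = ∷-⊆-++ c-emitted (Sublist.++⁺ (below-⊆-emitted stack post above c∉ γ<c γ⊆) (from∈ d∈))

obstruction⇒output : Unique π → Obstruction π γ → OutputPattern (PSB π) γ
obstruction⇒output u (ascent {c} {v} γ<c c<v sub) with ∷-⊆-split sub
... | A , _ , refl , v∷γ⊆ with ∷-⊆-split v∷γ⊆
...   | A′ , post , refl , γ⊆ =
  subst (λ π → OutputPattern (PSB π) _) π≡
    (output-pattern (prefix ++ [ v ]) post (∈-++⁺ˡ (∈-++⁺ʳ A (here refl))) above c∉ γ<c γ⊆)
  where
    prefix = A ++ c ∷ A′
    π≡ : (prefix ++ [ v ]) ++ post ≡ A ++ c ∷ A′ ++ v ∷ post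
    π≡ = trans (++-assoc prefix [ v ] post) (++-assoc A (c ∷ A′) (v ∷ post))
    above : Above c (stackAfter [] (prefix ++ [ v ]))
    above = subst (Above c) (sym (stackAfter-++ [] prefix [ v ]))
      (NonEmptyAll-map (<-≤-trans c<v) (StepView-≥ (stackAfter-Consecutive [] prefix []) (stepView _ v)))
    c∉ : c ∉ post
    c∉ = Unique-∉ A u ∘ ∈-++⁺ʳ A′ ∘ there
obstruction⇒output u (hook {c} {v} {t} γ<c c<v v<t s sub) with ∷-⊆-split sub
... | A , _ , refl , c∷τ⊆ with ∷-⊆-split c∷τ⊆
...   | A′ , post , refl , τ⊆ =
  subst (λ π → OutputPattern (PSB π) _) π≡
    (output-pattern (prefix ++ [ c ]) post (∈-++⁺ʳ prefix (here refl)) above c∉ γ<c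
      (⊆-trans (Shuffle-⊆ʳ s) τ⊆))
  where
    prefix = A ++ t ∷ A′
    prefix∷c≡ : prefix ++ c ∷ post ≡ A ++ t ∷ A′ ++ c ∷ post
    prefix∷c≡ = ++-assoc A (t ∷ A′) (c ∷ post)
    π≡ : (prefix ++ [ c ]) ++ post ≡ A ++ t ∷ A′ ++ c ∷ post
    π≡ = trans (++-assoc prefix [ c ] post) prefix∷c≡
    u-prefix : Unique (prefix ++ c ∷ post)
    u-prefix = subst Unique (sym prefix∷c≡) u
    reach : Any (t ≤_) (stackAfter [] prefix)
    reach = subst (Any (t ≤_)) (sym (stackAfter-++ [] A (t ∷ A′)))
      (stackAfter-reaches (stackAfter [] A) A′ (stackAfter-Consecutive [] A []) (Unique-stackAfter [] A u))
    stack-disjoint : ∀ {y} → y ∈ stackAfter [] prefix → y ∉ c ∷ post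
    stack-disjoint y∈ y∈′ =
      Unique-++-disjoint (stackAfter [] prefix) (Unique-stackAfter [] prefix u-prefix) y∈ y∈′ refl
    above : Above c (stackAfter [] (prefix ++ [ c ]))
    above = subst (Above c) (sym (stackAfter-++ [] prefix [ c ]))
      (StepView-forced-bypass (stackAfter-Consecutive [] prefix []) reach (λ c∈ → stack-disjoint c∈ (here refl))
        (λ v∈ → stack-disjoint v∈ (there (Sublist.Any-resp-⊆ τ⊆ (Shuffle-∈ˡ s)))) c<v v<t (stepView _ c))
    c∉ : c ∉ post
    c∉ = Unique-∉ prefix u-prefix

-- From an occurrence in the output to an obstruction

Consecutive-⊆-split : ∀ E {R} → Consecutive E → All (_< c) γ → (c ∷ γ) ⊆ E ++ R →
                      (c ∷ γ) ⊆ R ⊎ (c ∈ E × γ ⊆ R)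
Consecutive-⊆-split [] _ _ sub = inj₁ sub
Consecutive-⊆-split (y ∷ E) cs γ<c (_ ∷ʳ sub) with Consecutive-⊆-split E (Consecutive-tail cs) γ<c sub
... | inj₁ sub′ = inj₁ sub′
... | inj₂ (c∈ , γ⊆) = inj₂ (there c∈ , γ⊆)
Consecutive-⊆-split (y ∷ E) cs γ<c (refl ∷ sub) = inj₂ (here refl , ⊆-skip-above E (Consecutive-head< cs) γ<c sub)

locate-emission : ∀ S xs → Consecutive S → γ ≢ [] → All (_< c) γ → (c ∷ γ) ⊆ psbRun S xs →
  ∃₂ λ p₁ x → ∃ λ p₂ → xs ≡ p₁ ++ x ∷ p₂ × c ∈ stepOutput (stackAfter S p₁) x ×
                       γ ⊆ psbRun (nextStack (stackAfter S p₁) x) p₂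
locate-emission S [] cs γ≢[] γ<c sub
  with Consecutive-⊆-split S cs γ<c (subst (_ ⊆_) (sym (++-identityʳ S)) sub)
... | inj₂ (_ , []) = ⊥-elim (γ≢[] refl)
locate-emission S (x ∷ xs) cs γ≢[] γ<c sub
  with Consecutive-⊆-split (stepOutput S x) (StepView-Consecutive-output (stepView S x) cs) γ<c
         (subst (_ ⊆_) (psbRun-step S x xs) sub)
... | inj₂ (c∈out , γ⊆) = [] , x , xs , refl , c∈out , γ⊆
... | inj₁ sub′ with locate-emission (nextStack S x) xs (StepView-Consecutive (stepView S x) cs) γ≢[] γ<c sub′
...   | p₁ , x′ , p₂ , refl , c∈out , γ⊆ = x ∷ p₁ , x′ , p₂ , refl , c∈out , γ⊆

module _ {m π} (π-perm : IsPerm m π) where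

  private
    π-unique : Unique π
    π-unique = IsPerm-Unique m π-perm

  successor-emitted : ∀ p₁ → π ≡ p₁ ++ c ∷ xs → Consecutive (t ∷ S) → stackAfter [] p₁ ≡ t ∷ S →
                      suc c < t → ¬ Any (λ v → c < v × v < t) xs → suc c ∈ emitted [] p₁
  successor-emitted {c} {t = t} p₁ π≡ cs stack≡ 1+c<t nothing-between
    with ∈-emitted⊎stackAfter [] p₁ 1+c∈p₁
    where
      t∈π : t ∈ π
      t∈π = subst (t ∈_) (sym π≡) (∈-++⁺ˡ (∈-stackAfter⁻ [] p₁ (subst (t ∈_) (sym stack≡) (here refl))))
      1+c∈p₁ : suc c ∈ p₁
      1+c∈π : suc c ∈ π
      1+c∈π = IsPerm-≤⇒∈ π-perm (≤-trans (<⇒≤ 1+c<t) (IsPerm-∈⇒≤ π-perm t∈π))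
      1+c∈p₁ with ∈-++⁻ p₁ (subst (suc c ∈_) π≡ 1+c∈π)
      ... | inj₁ 1+c∈ = 1+c∈
      ... | inj₂ (here 1+c≡c) = ⊥-elim (<-irrefl (sym 1+c≡c) (n<1+n c))
      ... | inj₂ (there 1+c∈xs) = ⊥-elim (nothing-between (lose 1+c∈xs (n<1+n c , 1+c<t)))
  ... | inj₁ 1+c∈emitted = 1+c∈emitted
  ... | inj₂ 1+c∈stack = ⊥-elim (<⇒≱ 1+c<t (Consecutive-head≤ cs (subst (suc c ∈_) stack≡ 1+c∈stack)))

  emission-obstruction : ∀ k p₁ → length p₁ < k → π ≡ p₁ ++ x ∷ xs →
                         c ∈ stepOutput (stackAfter [] p₁) x → All (_< c) γ → γ ⊆ xs → Obstruction π γ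
  emission-obstruction {x} {xs} (suc k) p₁ len π≡ c∈ γ<c γ⊆
    with stackAfter [] p₁ in stack≡ | stackAfter-Consecutive [] p₁ []
       | stackAfter-∉ p₁ (subst Unique π≡ π-unique)
  ... | S | cs | x∉stack with nextStack S x | stepOutput S x | stepView S x
  ...   | _ | _ | pop t≤x =
    ascent γ<c (Consecutive-<-absent cs c∈ t≤x x∉stack)
      (subst (_ ⊆_) (sym π≡) (∷-⊆-++ (∈-stackAfter⁻ [] p₁ (subst (_ ∈_) (sym stack≡) c∈)) (refl ∷ γ⊆)))
  emission-obstruction {c} {xs} (suc k) p₁ len π≡ (here refl) γ<c γ⊆
    | t ∷ _ | cs | _ | _ | _ | bypass 1+c<t with any? (λ v → (c <? v) ×-dec (v <? t)) xs
  ... | yes between with find between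
  ...   | v , v∈ , c<v , v<t with Shuffle-⊆ v∈ γ⊆ (λ v∈γ → <-asym c<v (All.lookup γ<c v∈γ))
  ...     | τ , τ⊆ , s =
    hook γ<c c<v v<t s (subst (_ ⊆_) (sym π≡)
      (∷-⊆-++ (∈-stackAfter⁻ [] p₁ (subst (t ∈_) (sym stack≡) (here refl))) (refl ∷ τ⊆)))
  emission-obstruction {c} {xs} (suc k) p₁ len π≡ (here refl) γ<c γ⊆
    | t ∷ _ | cs | _ | _ | _ | bypass 1+c<t | no nothing-between
    with emitted-step [] p₁ (successor-emitted p₁ π≡ cs stack≡ 1+c<t nothing-between)
  ... | q₁ , y , q₂ , refl , 1+c∈out =
    emission-obstruction k q₁ (<-≤-trans (length-<-++-∷ q₁) (≤-pred len))
      (trans π≡ (++-assoc q₁ (y ∷ q₂) (c ∷ xs)))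
      1+c∈out (All.map (flip <-trans (n<1+n c)) γ<c) (Sublist.++⁺ˡ q₂ (c ∷ʳ γ⊆))

  output⇒obstruction : γ ≢ [] → All (_< c) γ → (c ∷ γ) ⊆ PSB π → Obstruction π γ
  output⇒obstruction {c = c} γ≢[] γ<c sub with locate-emission [] π [] γ≢[] γ<c sub
  ... | p₁ , x , p₂ , π≡ , c∈out , γ⊆ =
    emission-obstruction (suc (length p₁)) p₁ ≤-refl π≡ c∈out γ<c
      (below-⊆-input (nextStack stack x) p₂ (StepView-emits-Above cs x∉stack (stepView stack x) c∈out)
        c∉p₂ γ<c γ⊆)
    where
      stack = stackAfter [] p₁
      cs = stackAfter-Consecutive [] p₁ []
      u : Unique (p₁ ++ x ∷ p₂)
      u = subst Unique π≡ π-unique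
      x∉stack = stackAfter-∉ p₁ u
      c∈p₁∷x : c ∈ p₁ ++ [ x ]
      c∈p₁∷x with ∈-++⁻ stack (∈-stepOutput⁻ stack x c∈out)
      ... | inj₁ c∈stack = ∈-++⁺ˡ (∈-stackAfter⁻ [] p₁ c∈stack)
      ... | inj₂ c∈x = ∈-++⁺ʳ p₁ c∈x
      c∉p₂ : c ∉ p₂
      c∉p₂ c∈p₂ =
        Unique-++-disjoint (p₁ ++ [ x ]) (subst Unique (sym (++-assoc p₁ [ x ] p₂)) u) c∈p₁∷x c∈p₂ refl

module _ {n m : ℕ} {α π : List ℕ} (α<n-1 : All (_< n ∸ 1) α) (n-1<n : n ∸ 1 < n) (α≢[] : α ≢ [])
         (π-perm : IsPerm m π) where

  open BasisTranslation α<n-1 n-1<n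

  private
    π-unique : Unique π
    π-unique = IsPerm-Unique m π-perm

  PSB-contains-ρ⇔basis : Contains (PSB π) (n ∸ 1 ∷ α ++ [ n ]) ⇔ (∃ λ β → BasisB n α β × Contains π β)
  PSB-contains-ρ⇔basis = mk⇔ to from
    where
      to : Contains (PSB π) (n ∸ 1 ∷ α ++ [ n ]) → ∃ λ β → BasisB n α β × Contains π β
      to ρ-in-output with ρ-occurrence⁻ α<n-1 (PSB-Unique π-unique) ρ-in-output
      ... | γ , iso , _ , γ<c , sub =
        obstruction⇒basis iso (output⇒obstruction π-perm (OrderIso-≢[] iso α≢[]) γ<c sub)
      from : (∃ λ β → BasisB n α β × Contains π β) → Contains (PSB π) (n ∸ 1 ∷ α ++ [ n ])
      from (_ , β∈B , β-in-π) with basis⇒obstruction π-unique β∈B β-in-π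
      ... | γ , iso , obstruction = ρ-occurrence⁺ α<n-1 n-1<n iso (obstruction⇒output π-unique obstruction)

mainTheorem8 : (n : ℕ) → 3 ≤ n → (α : List ℕ) → IsPerm (n ∸ 2) α →
    (m : ℕ) (π : List ℕ) → IsPerm m π →
    Avoids (PSB π) ((n ∸ 1) ∷ (α ++ [ n ])) ⇔ InAv (BasisB n α) π
mainTheorem8 n 3≤n α α-perm m π π-perm =
  mk⇔ (λ avoids β β∈B β-in-π → avoids (from (β , β∈B , β-in-π)))
      (λ avoids-B ρ-in-output → let β , β∈B , β-in-π = to ρ-in-output in avoids-B β β∈B β-in-π)
  where
    n-1<n : n ∸ 1 < n
    n-1<n = ∸-monoʳ-< (s≤s z≤n) (≤-trans (s≤s z≤n) 3≤n)
    α<n-1 : All (_< n ∸ 1) α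
    α<n-1 = All.tabulate λ a∈α →
      ≤-<-trans (IsPerm-∈⇒≤ α-perm a∈α) (∸-monoʳ-< (n<1+n 1) (≤-trans (n≤1+n 2) 3≤n))
    α≢[] : α ≢ []
    α≢[] = ∈⇒≢[] (IsPerm-≤⇒∈ α-perm (∸-monoˡ-≤ 2 3≤n))
    open Equivalence (PSB-contains-ρ⇔basis α<n-1 n-1<n α≢[] π-perm)
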